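{- Let $p>5$ be a prime and let $(x,y,z)\in\mathbb{F}_p^3$ be a singular triple, i.e. $x^2+y^2+z^2-xyz-2=2$. Then $(x,y,z)$ cannot have both a hyperbolic and an elliptic coordinate. Moreover, exactly one of the following holds: (i) at least two of $x,y,z$ are hyperbolic; (ii) at least two of $x,y,z$ are elliptic; (iii) all three of $x,y,z$ are parabolic.
   Context: An element $t\in\mathbb{F}_p$ is hyperbolic if $t^2-4$ is a nonzero square in $\mathbb{F}_p$, parabolic if $t=\pm2$, and elliptic if $t^2-4$ is not a square in $\mathbb{F}_p$. -}

module Defs where

open import Data.Nat using (ℕ; _+_; _*_; _%_; NonZero)
open import Data.Nat.Primality using (Prime)
open import Data.Fin using (Fin; toℕ)
open import Data.Product using (Σ; ∃; _×_)
open import Data.Sum using (_⊎_)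
open import Relation.Nullary using (¬_)
open import Relation.Binary.PropositionalEquality using (_≡_)

-- Elements of 𝔽_p are represented by Fin p (residues 0..p-1); arithmetic is
-- done in ℕ and compared modulo p.
_≡[_]_ : ℕ → (p : ℕ) → .{{NonZero p}} → ℕ → Set
a ≡[ p ] b = a % p ≡ b % p

module _ (p : ℕ) .{{_ : NonZero p}} where

  -- t² - 4 is a square: ∃ s ∈ 𝔽_p, s² = t² - 4, i.e. s² + 4 = t²
  Disc-square : Fin p → Set
  Disc-square t = ∃ λ (s : Fin p) → (toℕ s * toℕ s + 4) ≡[ p ] (toℕ t * toℕ t)

  Disc-nonzero : Fin p → Set
  Disc-nonzero t = ¬ ((toℕ t * toℕ t) ≡[ p ] 4)

  Hyperbolic : Fin p → Set
  Hyperbolic t = Disc-nonzero t × Disc-square t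

  -- t = 2 or t = -2  (t + 2 = 0)
  Parabolic : Fin p → Set
  Parabolic t = (toℕ t ≡[ p ] 2) ⊎ ((toℕ t + 2) ≡[ p ] 0)

  Elliptic : Fin p → Set
  Elliptic t = ¬ Disc-square t

  -- x² + y² + z² - xyz - 2 = 2, i.e. x² + y² + z² = xyz + 4
  Singular : Fin p → Fin p → Fin p → Set
  Singular x y z =
    (toℕ x * toℕ x + toℕ y * toℕ y + toℕ z * toℕ z)
      ≡[ p ] (toℕ x * toℕ y * toℕ z + 4)

  AtLeastTwo : (Fin p → Set) → Fin p → Fin p → Fin p → Set
  AtLeastTwo P x y z = (P x × P y) ⊎ (P x × P z) ⊎ (P y × P z)

  AllThree : (Fin p → Set) → Fin p → Fin p → Fin p → Set
  AllThree P x y z = P x × P y × P z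

  ExactlyOne : Set → Set → Set → Set
  ExactlyOne A B C =
    (A ⊎ B ⊎ C) × (¬ (A × B)) × (¬ (A × C)) × (¬ (B × C))

-- On a singular triple the identity
--   (2z - xy)² - (x² - 4)(y² - 4) = 4 (x² + y² + z² - xyz - 4)
-- makes (x² - 4)(y² - 4) a square.  If x is hyperbolic then x² - 4 = s² with s ≠ 0,
-- so y² - 4 = ((2z - xy)/s)² is a square as well and y is not elliptic.  If y = ±2, the
-- singular equation becomes (x ∓ z)² = 0, so z² = x²; since the type of t only depends on t²,
-- z then has the type of x.  Hence two coordinates share a non-parabolic type unless all three
-- are parabolic, and the three alternatives exclude each other because the types do.

module Submission where

open import Defs
open import Data.Nat using (ℕ; _<_; NonZero)
open import Data.Nat.Primality using (Prime)
open import Data.Fin using (Fin)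
open import Data.Product using (_×_)
open import Data.Sum using (_⊎_)
open import Relation.Nullary using (¬_)

import Data.Nat as ℕ
open import Data.Nat.Coprimality using (prime⇒coprime; coprime-Bézout)
open import Data.Nat.DivMod using ([m+kn]%n≡m%n)
open import Data.Nat.GCD using (module Bézout)
open import Data.Nat.Primality using (euclidsLemma)
open import Data.Nat.Divisibility using () renaming (_∣_ to _∣ℕ_)
open import Data.Fin using (toℕ; fromℕ<)
open import Data.Fin.Properties using (toℕ-fromℕ<; toℕ<n; any?)
open import Data.Integer using (ℤ; +_; -[1+_]; 0ℤ; 1ℤ; _+_; _*_; -_; _-_)
import Data.Integer.Properties as ℤ
open import Data.Integer.Base using (_%ℕ_; _/ℕ_) renaming (∣_∣ to abs)
open import Data.Integer.DivMod using (n%ℕd<d; a≡a%ℕn+[a/ℕn]*n)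
open import Data.Integer.Divisibility.Signed
  using (_∣_; divides; ∣ᵤ⇒∣; ∣⇒∣ᵤ; ∣m∣n⇒∣m+n; ∣m∣n⇒∣m-n; ∣m⇒∣-m; ∣m⇒∣m*n; ∣n⇒∣m*n)
open import Data.Integer.Tactic.RingSolver using (solve)
open import Data.List using (_∷_; [])
open import Data.Product using (∃; _,_; proj₁; proj₂)
open import Data.Sum using (inj₁; inj₂)
import Data.Sum as Sum
open import Data.Empty using (⊥-elim)
open import Function using (_∘_)
open import Level using (0ℓ)
open import Relation.Nullary using (Dec; yes; no)
open import Relation.Binary.Bundles using (Setoid)
open import Relation.Binary.PropositionalEquality
  using (_≡_; refl; sym; trans; cong; cong₂; subst; subst₂; module ≡-Reasoning)
import Relation.Binary.Reasoning.Setoid as SetoidReasoning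

module Congruence (p : ℕ) .{{_ : NonZero p}} where

  ∣-resp : ∀ {i j} → + p ∣ i → i ≡ j → + p ∣ j
  ∣-resp d refl = d

  infix 4 _≈_
  record _≈_ (i j : ℤ) : Set where
    constructor mk≈
    field ∣-difference : + p ∣ i - j
  open _≈_ public

  ≈-reflexive : ∀ {i j} → i ≡ j → i ≈ j
  ≈-reflexive {i} refl = mk≈ (divides 0ℤ (trans (ℤ.+-inverseʳ i) (sym (ℤ.*-zeroˡ (+ p)))))

  ≈-refl : ∀ {i} → i ≈ i
  ≈-refl = ≈-reflexive refl

  ≈-sym : ∀ {i j} → i ≈ j → j ≈ i
  ≈-sym {i} {j} (mk≈ d) = mk≈ (∣-resp (∣m⇒∣-m d) (solve (i ∷ j ∷ [])))

  ≈-trans : ∀ {i j k} → i ≈ j → j ≈ k → i ≈ k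
  ≈-trans {i} {j} {k} (mk≈ d) (mk≈ e) = mk≈ (∣-resp (∣m∣n⇒∣m+n d e) (ℤ.+-minus-telescope i j k))

  ≈-setoid : Setoid 0ℓ 0ℓ
  ≈-setoid = record
    { Carrier = ℤ
    ; _≈_ = _≈_
    ; isEquivalence = record { refl = ≈-refl ; sym = ≈-sym ; trans = ≈-trans }
    }

  +-cong : ∀ {a b c d} → a ≈ b → c ≈ d → a + c ≈ b + d
  +-cong {a} {b} {c} {d} (mk≈ e) (mk≈ f) =
    mk≈ (∣-resp (∣m∣n⇒∣m+n e f) (solve (a ∷ b ∷ c ∷ d ∷ [])))

  *-cong : ∀ {a b c d} → a ≈ b → c ≈ d → a * c ≈ b * d
  *-cong {a} {b} {c} {d} (mk≈ e) (mk≈ f) =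
    mk≈ (∣-resp (∣m∣n⇒∣m+n (∣m⇒∣m*n c e) (∣n⇒∣m*n b f)) (solve (a ∷ b ∷ c ∷ d ∷ [])))

  +≈⇒≈- : ∀ {a b c} → a + b ≈ c → a ≈ c - b
  +≈⇒≈- {a} {b} {c} (mk≈ d) = mk≈ (∣-resp d (solve (a ∷ b ∷ c ∷ [])))

  ≈-⇒+≈ : ∀ {a b c} → a ≈ c - b → a + b ≈ c
  ≈-⇒+≈ {a} {b} {c} (mk≈ d) = mk≈ (∣-resp d (solve (a ∷ b ∷ c ∷ [])))

  ≈0⇒∣ : ∀ {i} → i ≈ 0ℤ → + p ∣ i
  ≈0⇒∣ {i} (mk≈ d) = ∣-resp d (ℤ.+-identityʳ i)

  ∣⇒≈0 : ∀ {i} → + p ∣ i → i ≈ 0ℤ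
  ∣⇒≈0 {i} d = mk≈ (∣-resp d (sym (ℤ.+-identityʳ i)))

  ≡[]⇒≈ : ∀ {a b} → a ≡[ p ] b → + a ≈ + b
  ≡[]⇒≈ {a} {b} a≡b = mk≈ (divides (qa - qb) (begin
    + a - + b
      ≡⟨ cong₂ _-_ (a≡a%ℕn+[a/ℕn]*n (+ a) p) (a≡a%ℕn+[a/ℕn]*n (+ b) p) ⟩
    (+ (a ℕ.% p) + qa * + p) - (+ (b ℕ.% p) + qb * + p)
      ≡⟨ cong (λ r → (+ r + qa * + p) - (+ (b ℕ.% p) + qb * + p)) a≡b ⟩
    (+ (b ℕ.% p) + qa * + p) - (+ (b ℕ.% p) + qb * + p)
      ≡⟨ cancel (+ (b ℕ.% p)) qa qb (+ p) ⟩
    (qa - qb) * + p ∎))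
    where
    open ≡-Reasoning
    qa qb : ℤ
    qa = + (a ℕ./ p)
    qb = + (b ℕ./ p)
    cancel : ∀ r A B P → (r + A * P) - (r + B * P) ≡ (A - B) * P
    cancel r A B P = solve (r ∷ A ∷ B ∷ P ∷ [])

  i-j≡q⇒i≡j+q : ∀ i j {q} → i - j ≡ q → i ≡ j + q
  i-j≡q⇒i≡j+q i j refl = solve (i ∷ j ∷ [])

  ≡+multiple⇒≡[] : ∀ {a b} k → + a ≡ + b + + k * + p → a ≡[ p ] b
  ≡+multiple⇒≡[] {a} {b} k a≡b+kp =
    trans (cong (ℕ._% p) (ℤ.+-injective (trans a≡b+kp (cong (_+_ (+ b)) (sym (ℤ.pos-* k p))))))
          ([m+kn]%n≡m%n b k p)

  ≈⇒≡[] : ∀ {a b} → + a ≈ + b → a ≡[ p ] b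
  ≈⇒≡[] {a} {b} (mk≈ (divides (+ k) a-b≡kp)) =
    ≡+multiple⇒≡[] k (i-j≡q⇒i≡j+q (+ a) (+ b) a-b≡kp)
  ≈⇒≡[] {a} {b} (mk≈ (divides -[1+ k ] a-b≡-kp)) =
    sym (≡+multiple⇒≡[] (ℕ.suc k) (i-j≡q⇒i≡j+q (+ b) (+ a)
      (trans (i-j≡q⇒j-i≡-q (+ a) (+ b) a-b≡-kp) (ℤ.neg-distribˡ-* -[1+ k ] (+ p)))))
    where
    i-j≡q⇒j-i≡-q : ∀ i j {q} → i - j ≡ q → j - i ≡ - q
    i-j≡q⇒j-i≡-q i j refl = solve (i ∷ j ∷ [])

  ⟦_⟧ : Fin p → ℤ
  ⟦ t ⟧ = + toℕ t

  ⟦⟧-square : ∀ t → + (toℕ t ℕ.* toℕ t) ≡ ⟦ t ⟧ * ⟦ t ⟧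
  ⟦⟧-square t = ℤ.pos-* (toℕ t) (toℕ t)

  fromℤ : ℤ → Fin p
  fromℤ i = fromℕ< (n%ℕd<d i p)

  ⟦fromℤ⟧≈ : ∀ i → ⟦ fromℤ i ⟧ ≈ i
  ⟦fromℤ⟧≈ i = ≈-sym (mk≈ (divides (i /ℕ p)
    (trans (cong (_-_ i) (cong +_ (toℕ-fromℕ< (n%ℕd<d i p))))
           (i≡j+q⇒i-j≡q i (+ (i %ℕ p)) (a≡a%ℕn+[a/ℕn]*n i p)))))
    where
    i≡j+q⇒i-j≡q : ∀ i j {q} → i ≡ j + q → i - j ≡ q
    i≡j+q⇒i-j≡q _ j {q} refl = solve (j ∷ q ∷ [])

  -- ⟦ t ⟧ - (- 2) reduces to ⟦ t ⟧ + 2, which is how Defs encodes t = -2.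
  parabolic⇒≈±2 : ∀ {t} → Parabolic p t → ⟦ t ⟧ ≈ + 2 ⊎ ⟦ t ⟧ ≈ - + 2
  parabolic⇒≈±2 = Sum.map ≡[]⇒≈ (λ t+2≡0 → mk≈ (≈0⇒∣ (≡[]⇒≈ t+2≡0)))

  ≈±2⇒parabolic : ∀ {t} → ⟦ t ⟧ ≈ + 2 ⊎ ⟦ t ⟧ ≈ - + 2 → Parabolic p t
  ≈±2⇒parabolic = Sum.map ≈⇒≡[] (λ t≈-2 → ≈⇒≡[] (∣⇒≈0 (∣-difference t≈-2)))

  parabolic⇒square≈4 : ∀ {t} → Parabolic p t → ⟦ t ⟧ * ⟦ t ⟧ ≈ + 4
  parabolic⇒square≈4 par =
    Sum.[ (λ t≈2 → *-cong t≈2 t≈2) , (λ t≈-2 → *-cong t≈-2 t≈-2) ] (parabolic⇒≈±2 par)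

  disc-square : ∀ t W → W * W + + 4 ≈ ⟦ t ⟧ * ⟦ t ⟧ → Disc-square p t
  disc-square t W W²+4≈t² = fromℤ W , ≈⇒≡[] (subst₂ _≈_
    (cong (_+ + 4) (sym (⟦⟧-square (fromℤ W)))) (sym (⟦⟧-square t))
    (≈-trans (+-cong (*-cong (⟦fromℤ⟧≈ W) (⟦fromℤ⟧≈ W)) ≈-refl) W²+4≈t²))

  square-quotient : ∀ {u S A D} → u * S ≈ 1ℤ → S * S * A ≈ D * D → A ≈ (u * D) * (u * D)
  square-quotient {u} {S} {A} {D} uS≈1 S²A≈D² = begin
    A                       ≡⟨ solve (A ∷ []) ⟩
    1ℤ * 1ℤ * A             ≈⟨ *-cong (*-cong (≈-sym uS≈1) (≈-sym uS≈1)) ≈-refl ⟩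
    (u * S) * (u * S) * A   ≡⟨ solve (u ∷ S ∷ A ∷ []) ⟩
    u * u * (S * S * A)     ≈⟨ *-cong (≈-refl {u * u}) S²A≈D² ⟩
    u * u * (D * D)         ≡⟨ solve (u ∷ D ∷ []) ⟩
    (u * D) * (u * D)       ∎
    where open SetoidReasoning ≈-setoid

  Singularℤ : ℤ → ℤ → ℤ → Set
  Singularℤ X Y Z = X * X + Y * Y + Z * Z ≈ X * Y * Z + + 4

  singularℤ-swap₁₂ : ∀ X Y Z → Singularℤ X Y Z → Singularℤ Y X Z
  singularℤ-swap₁₂ X Y Z sing = begin
    Y * Y + X * X + Z * Z  ≡⟨ solve (X ∷ Y ∷ Z ∷ []) ⟩
    X * X + Y * Y + Z * Z  ≈⟨ sing ⟩
    X * Y * Z + + 4        ≡⟨ solve (X ∷ Y ∷ Z ∷ []) ⟩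
    Y * X * Z + + 4        ∎
    where open SetoidReasoning ≈-setoid

  singularℤ-swap₂₃ : ∀ X Y Z → Singularℤ X Y Z → Singularℤ X Z Y
  singularℤ-swap₂₃ X Y Z sing = begin
    X * X + Z * Z + Y * Y  ≡⟨ solve (X ∷ Y ∷ Z ∷ []) ⟩
    X * X + Y * Y + Z * Z  ≈⟨ sing ⟩
    X * Y * Z + + 4        ≡⟨ solve (X ∷ Y ∷ Z ∷ []) ⟩
    X * Z * Y + + 4        ∎
    where open SetoidReasoning ≈-setoid

  singularℤ⇒disc-product : ∀ X Y Z → Singularℤ X Y Z →
    (X * X - + 4) * (Y * Y - + 4) ≈ (+ 2 * Z - X * Y) * (+ 2 * Z - X * Y)
  singularℤ⇒disc-product X Y Z (mk≈ sing) =
    ≈-sym (mk≈ (∣-resp (∣n⇒∣m*n (+ 4) sing) (solve (X ∷ Y ∷ Z ∷ []))))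

module PrimeCongruence (p : ℕ) .{{_ : NonZero p}} (p-prime : Prime p) where
  open Congruence p

  ∣*⇒∣⊎∣ : ∀ i j → + p ∣ i * j → + p ∣ i ⊎ + p ∣ j
  ∣*⇒∣⊎∣ i j p∣ij = Sum.map ∣ᵤ⇒∣ ∣ᵤ⇒∣
    (euclidsLemma (abs i) (abs j) p-prime (subst (p ∣ℕ_) (ℤ.abs-* i j) (∣⇒∣ᵤ p∣ij)))

  ∣square⇒∣ : ∀ {i} → + p ∣ i * i → + p ∣ i
  ∣square⇒∣ {i} = Sum.reduce ∘ ∣*⇒∣⊎∣ i i

  square≈4⇒≈±2 : ∀ {i} → i * i ≈ + 4 → i ≈ + 2 ⊎ i ≈ - + 2
  square≈4⇒≈±2 {i} (mk≈ d) =
    Sum.map mk≈ mk≈ (∣*⇒∣⊎∣ (i - + 2) (i - - + 2) (∣-resp d (solve (i ∷ []))))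

  bézout-in-ℤ : ∀ a b c d → 1 ℕ.+ a ℕ.* b ≡ c ℕ.* d → 1ℤ + + a * + b ≡ + c * + d
  bézout-in-ℤ a b c d eq =
    trans (cong (_+_ 1ℤ) (sym (ℤ.pos-* a b))) (trans (cong +_ eq) (ℤ.pos-* c d))

  inverseℕ : ∀ {n} .{{_ : NonZero n}} → n < p → ∃ λ u → u * + n ≈ 1ℤ
  inverseℕ {n} n<p with coprime-Bézout (prime⇒coprime p-prime n<p)
  ... | Bézout.+- x y 1+yn≡xp =
    - + y , mk≈ (divides (- + x)
      (trans (1+ab≡c⇒-ab-1≡-c (+ y) (+ n) (bézout-in-ℤ y n x p 1+yn≡xp))
             (ℤ.neg-distribˡ-* (+ x) (+ p))))
    where
    1+ab≡c⇒-ab-1≡-c : ∀ a b {c} → 1ℤ + a * b ≡ c → - a * b - 1ℤ ≡ - c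
    1+ab≡c⇒-ab-1≡-c a b refl = solve (a ∷ b ∷ [])
  ... | Bézout.-+ x y 1+xp≡yn =
    + y , mk≈ (divides (+ x) (1+a≡c⇒c-1≡a (+ x * + p) (bézout-in-ℤ x p y n 1+xp≡yn)))
    where
    1+a≡c⇒c-1≡a : ∀ a {c} → 1ℤ + a ≡ c → c - 1ℤ ≡ a
    1+a≡c⇒c-1≡a a refl = solve (a ∷ [])

  inverse : ∀ {i} → ¬ (i ≈ 0ℤ) → ∃ λ u → u * i ≈ 1ℤ
  inverse {i} i≉0 = invert (toℕ (fromℤ i)) (toℕ<n (fromℤ i)) (⟦fromℤ⟧≈ i)
    where
    invert : ∀ n → n < p → + n ≈ i → ∃ λ u → u * i ≈ 1ℤ
    invert ℕ.zero    _   0≈i = ⊥-elim (i≉0 (≈-sym 0≈i))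
    invert (ℕ.suc n) n<p n≈i with inverseℕ n<p
    ... | u , un≈1 = u , ≈-trans (*-cong (≈-refl {u}) (≈-sym n≈i)) un≈1

  singularℤ-y≈±2⇒z²≈x² : ∀ X Y Z → Singularℤ X Y Z → Y ≈ + 2 ⊎ Y ≈ - + 2 → Z * Z ≈ X * X
  singularℤ-y≈±2⇒z²≈x² X Y Z (mk≈ sing) (inj₁ (mk≈ Y-2)) = *-cong (≈-sym X≈Z) (≈-sym X≈Z)
    where
    X≈Z : X ≈ Z
    X≈Z = mk≈ (∣square⇒∣ (∣-resp (∣m∣n⇒∣m-n sing (∣m⇒∣m*n (Y + + 2 - X * Z) Y-2))
                                 (solve (X ∷ Y ∷ Z ∷ []))))
  singularℤ-y≈±2⇒z²≈x² X Y Z (mk≈ sing) (inj₂ (mk≈ Y+2)) = begin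
    Z * Z            ≡⟨ solve (Z ∷ []) ⟩
    (- Z) * (- Z)    ≈⟨ *-cong (≈-sym X≈-Z) (≈-sym X≈-Z) ⟩
    X * X            ∎
    where
    open SetoidReasoning ≈-setoid
    X≈-Z : X ≈ - Z
    X≈-Z = mk≈ (∣square⇒∣ (∣-resp (∣m∣n⇒∣m-n sing (∣m⇒∣m*n (Y - + 2 - X * Z) Y+2))
                                  (solve (X ∷ Y ∷ Z ∷ []))))

module SingularTriples (p : ℕ) .{{_ : NonZero p}} (p-prime : Prime p) where
  open Congruence p
  open PrimeCongruence p p-prime

  parabolic⇒square≡4 : ∀ {t} → Parabolic p t → (toℕ t ℕ.* toℕ t) ≡[ p ] 4
  parabolic⇒square≡4 {t} = ≈⇒≡[] ∘ subst₂ _≈_ (sym (⟦⟧-square t)) refl ∘ parabolic⇒square≈4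

  square≡4⇒parabolic : ∀ {t} → (toℕ t ℕ.* toℕ t) ≡[ p ] 4 → Parabolic p t
  square≡4⇒parabolic {t} = ≈±2⇒parabolic ∘ square≈4⇒≈±2 ∘ subst₂ _≈_ (⟦⟧-square t) refl ∘ ≡[]⇒≈

  hyperbolic⇒¬elliptic : ∀ t → Hyperbolic p t → ¬ Elliptic p t
  hyperbolic⇒¬elliptic _ (_ , square) elliptic = elliptic square

  hyperbolic⇒¬parabolic : ∀ t → Hyperbolic p t → ¬ Parabolic p t
  hyperbolic⇒¬parabolic _ (t²≢4 , _) = t²≢4 ∘ parabolic⇒square≡4

  elliptic⇒¬parabolic : ∀ t → Elliptic p t → ¬ Parabolic p t
  elliptic⇒¬parabolic t elliptic parabolic =
    elliptic (disc-square t 0ℤ (≈-sym (parabolic⇒square≈4 parabolic)))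

  data Kind (t : Fin p) : Set where
    hyperbolic : Hyperbolic p t → Kind t
    elliptic   : Elliptic p t → Kind t
    parabolic  : Parabolic p t → Kind t

  disc-square? : ∀ t → Dec (Disc-square p t)
  disc-square? t = any? λ s → (toℕ s ℕ.* toℕ s ℕ.+ 4) ℕ.% p ℕ.≟ (toℕ t ℕ.* toℕ t) ℕ.% p

  kind : ∀ t → Kind t
  kind t with (toℕ t ℕ.* toℕ t) ℕ.% p ℕ.≟ 4 ℕ.% p | disc-square? t
  ... | yes t²≡4 | _          = parabolic (square≡4⇒parabolic t²≡4)
  ... | no  t²≢4 | yes square = hyperbolic (t²≢4 , square)
  ... | no  _    | no ¬square = elliptic ¬square

  SameSquare : Fin p → Fin p → Set
  SameSquare a b = (toℕ a ℕ.* toℕ a) ≡[ p ] (toℕ b ℕ.* toℕ b)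

  hyperbolic-resp : ∀ {a b} → SameSquare a b → Hyperbolic p b → Hyperbolic p a
  hyperbolic-resp a~b (b²≢4 , s , s²+4≡b²) = b²≢4 ∘ trans (sym a~b) , s , trans s²+4≡b² (sym a~b)

  elliptic-resp : ∀ {a b} → SameSquare a b → Elliptic p b → Elliptic p a
  elliptic-resp a~b b-elliptic (s , s²+4≡a²) = b-elliptic (s , trans s²+4≡a² a~b)

  parabolic-resp : ∀ {a b} → SameSquare a b → Parabolic p b → Parabolic p a
  parabolic-resp a~b = square≡4⇒parabolic ∘ trans a~b ∘ parabolic⇒square≡4

  record SingularTriple (x y z : Fin p) : Set where
    constructor mkSingularTriple
    field equation : Singularℤ ⟦ x ⟧ ⟦ y ⟧ ⟦ z ⟧

  singular⇒SingularTriple : ∀ {x y z} → Singular p x y z → SingularTriple x y z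
  singular⇒SingularTriple {x} {y} {z} sing = mkSingularTriple (subst₂ _≈_
    (cong₂ _+_ (cong₂ _+_ (⟦⟧-square x) (⟦⟧-square y)) (⟦⟧-square z))
    (cong (_+ + 4) (trans (ℤ.pos-* (toℕ x ℕ.* toℕ y) (toℕ z))
                          (cong (_* ⟦ z ⟧) (ℤ.pos-* (toℕ x) (toℕ y)))))
    (≡[]⇒≈ sing))

  singular-swap₁₂ : ∀ {x y z} → SingularTriple x y z → SingularTriple y x z
  singular-swap₁₂ {x} {y} {z} (mkSingularTriple sing) =
    mkSingularTriple (singularℤ-swap₁₂ ⟦ x ⟧ ⟦ y ⟧ ⟦ z ⟧ sing)

  singular-swap₂₃ : ∀ {x y z} → SingularTriple x y z → SingularTriple x z y
  singular-swap₂₃ {x} {y} {z} (mkSingularTriple sing) =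
    mkSingularTriple (singularℤ-swap₂₃ ⟦ x ⟧ ⟦ y ⟧ ⟦ z ⟧ sing)

  singular-hyperbolic⇒¬elliptic : ∀ {x y z} → SingularTriple x y z →
    Hyperbolic p x → ¬ Elliptic p y
  singular-hyperbolic⇒¬elliptic {x} {y} {z} (mkSingularTriple sing) (x²≢4 , s , s²+4≡x²) ey =
    ey (disc-square y (u * D) (≈-⇒+≈ {b = + 4} (≈-sym Y²-4≈[uD]²)))
    where
    open SetoidReasoning ≈-setoid
    X Y Z S D : ℤ
    X = ⟦ x ⟧
    Y = ⟦ y ⟧
    Z = ⟦ z ⟧
    S = ⟦ s ⟧
    D = + 2 * Z - X * Y

    S²+4≈X² : S * S + + 4 ≈ X * X
    S²+4≈X² = subst₂ _≈_ (cong (_+ + 4) (⟦⟧-square s)) (⟦⟧-square x) (≡[]⇒≈ s²+4≡x²)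

    S≉0 : ¬ (S ≈ 0ℤ)
    S≉0 S≈0 = x²≢4 (≈⇒≡[] (subst₂ _≈_ (sym (⟦⟧-square x)) refl (begin
      X * X          ≈⟨ ≈-sym S²+4≈X² ⟩
      S * S + + 4    ≈⟨ +-cong (*-cong S≈0 S≈0) (≈-refl {+ 4}) ⟩
      + 4            ∎)))

    u : ℤ
    u = proj₁ (inverse S≉0)

    X²-4≈S² : X * X - + 4 ≈ S * S
    X²-4≈S² = ≈-sym (+≈⇒≈- {b = + 4} S²+4≈X²)

    Y²-4≈[uD]² : Y * Y - + 4 ≈ (u * D) * (u * D)
    Y²-4≈[uD]² = square-quotient {u} {S} {D = D} (proj₂ (inverse S≉0)) (begin
      S * S * (Y * Y - + 4)            ≈⟨ *-cong (≈-sym X²-4≈S²) (≈-refl {Y * Y - + 4}) ⟩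
      (X * X - + 4) * (Y * Y - + 4)    ≈⟨ singularℤ⇒disc-product X Y Z sing ⟩
      D * D                            ∎)

  singular-parabolic⇒same-square : ∀ {x y z} → SingularTriple x y z → Parabolic p y → SameSquare z x
  singular-parabolic⇒same-square {x} {y} {z} (mkSingularTriple sing) y-parabolic =
    ≈⇒≡[] (subst₂ _≈_ (sym (⟦⟧-square z)) (sym (⟦⟧-square x))
      (singularℤ-y≈±2⇒z²≈x² ⟦ x ⟧ ⟦ y ⟧ ⟦ z ⟧ sing (parabolic⇒≈±2 y-parabolic)))

  singular⇒¬hyperbolic×elliptic : ∀ {x y z} → SingularTriple x y z →
    ¬ ((Hyperbolic p x ⊎ Hyperbolic p y ⊎ Hyperbolic p z)
       × (Elliptic p x ⊎ Elliptic p y ⊎ Elliptic p z))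
  singular⇒¬hyperbolic×elliptic {x} {y} {z} sing (inj₁ hx , inj₁ ex) =
    hyperbolic⇒¬elliptic x hx ex
  singular⇒¬hyperbolic×elliptic {x} {y} {z} sing (inj₁ hx , inj₂ (inj₁ ey)) =
    singular-hyperbolic⇒¬elliptic sing hx ey
  singular⇒¬hyperbolic×elliptic {x} {y} {z} sing (inj₁ hx , inj₂ (inj₂ ez)) =
    singular-hyperbolic⇒¬elliptic (singular-swap₂₃ sing) hx ez
  singular⇒¬hyperbolic×elliptic {x} {y} {z} sing (inj₂ (inj₁ hy) , inj₁ ex) =
    singular-hyperbolic⇒¬elliptic (singular-swap₁₂ sing) hy ex
  singular⇒¬hyperbolic×elliptic {x} {y} {z} sing (inj₂ (inj₁ hy) , inj₂ (inj₁ ey)) =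
    hyperbolic⇒¬elliptic y hy ey
  singular⇒¬hyperbolic×elliptic {x} {y} {z} sing (inj₂ (inj₁ hy) , inj₂ (inj₂ ez)) =
    singular-hyperbolic⇒¬elliptic (singular-swap₂₃ (singular-swap₁₂ sing)) hy ez
  singular⇒¬hyperbolic×elliptic {x} {y} {z} sing (inj₂ (inj₂ hz) , inj₁ ex) =
    singular-hyperbolic⇒¬elliptic (singular-swap₁₂ (singular-swap₂₃ sing)) hz ex
  singular⇒¬hyperbolic×elliptic {x} {y} {z} sing (inj₂ (inj₂ hz) , inj₂ (inj₁ ey)) =
    singular-hyperbolic⇒¬elliptic (singular-swap₁₂ (singular-swap₂₃ (singular-swap₁₂ sing))) hz ey
  singular⇒¬hyperbolic×elliptic {x} {y} {z} sing (inj₂ (inj₂ hz) , inj₂ (inj₂ ez)) =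
    hyperbolic⇒¬elliptic z hz ez

  singular⇒alternatives : ∀ {x y z} → SingularTriple x y z →
    AtLeastTwo p (Hyperbolic p) x y z ⊎ AtLeastTwo p (Elliptic p) x y z
      ⊎ AllThree p (Parabolic p) x y z
  singular⇒alternatives {x} {y} {z} sing = cases (kind x) (kind y)
    where
    z~x : Parabolic p y → SameSquare z x
    z~x = singular-parabolic⇒same-square sing

    z~y : Parabolic p x → SameSquare z y
    z~y = singular-parabolic⇒same-square (singular-swap₁₂ sing)

    cases : Kind x → Kind y →
      AtLeastTwo p (Hyperbolic p) x y z ⊎ AtLeastTwo p (Elliptic p) x y z
        ⊎ AllThree p (Parabolic p) x y z
    cases (hyperbolic hx) (hyperbolic hy) = inj₁ (inj₁ (hx , hy))
    cases (elliptic ex)   (elliptic ey)   = inj₂ (inj₁ (inj₁ (ex , ey)))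
    cases (hyperbolic hx) (elliptic ey)   =
      ⊥-elim (singular-hyperbolic⇒¬elliptic sing hx ey)
    cases (elliptic ex)   (hyperbolic hy) =
      ⊥-elim (singular-hyperbolic⇒¬elliptic (singular-swap₁₂ sing) hy ex)
    cases (hyperbolic hx) (parabolic py) =
      inj₁ (inj₂ (inj₁ (hx , hyperbolic-resp {z} {x} (z~x py) hx)))
    cases (elliptic ex)   (parabolic py) =
      inj₂ (inj₁ (inj₂ (inj₁ (ex , elliptic-resp {z} {x} (z~x py) ex))))
    cases (parabolic px)  (parabolic py) =
      inj₂ (inj₂ (px , py , parabolic-resp {z} {x} (z~x py) px))
    cases (parabolic px)  (hyperbolic hy) =
      inj₁ (inj₂ (inj₂ (hy , hyperbolic-resp {z} {y} (z~y px) hy)))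
    cases (parabolic px)  (elliptic ey) =
      inj₂ (inj₁ (inj₂ (inj₂ (ey , elliptic-resp {z} {y} (z~y px) ey))))

module _ {p : ℕ} .{{_ : NonZero p}} {P Q : Fin p → Set} (x y z : Fin p) where

  AtLeastTwo-disjoint : (∀ t → P t → ¬ Q t) → ¬ (AtLeastTwo p P x y z × AtLeastTwo p Q x y z)
  AtLeastTwo-disjoint P⇒¬Q = λ where
    (inj₁ (px , _)        , inj₁ (qx , _))        → P⇒¬Q x px qx
    (inj₁ (px , _)        , inj₂ (inj₁ (qx , _))) → P⇒¬Q x px qx
    (inj₁ (_ , py)        , inj₂ (inj₂ (qy , _))) → P⇒¬Q y py qy
    (inj₂ (inj₁ (px , _)) , inj₁ (qx , _))        → P⇒¬Q x px qx
    (inj₂ (inj₁ (px , _)) , inj₂ (inj₁ (qx , _))) → P⇒¬Q x px qx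
    (inj₂ (inj₁ (_ , pz)) , inj₂ (inj₂ (_ , qz))) → P⇒¬Q z pz qz
    (inj₂ (inj₂ (py , _)) , inj₁ (_ , qy))        → P⇒¬Q y py qy
    (inj₂ (inj₂ (_ , pz)) , inj₂ (inj₁ (_ , qz))) → P⇒¬Q z pz qz
    (inj₂ (inj₂ (py , _)) , inj₂ (inj₂ (qy , _))) → P⇒¬Q y py qy

  AtLeastTwo-AllThree-disjoint : (∀ t → P t → ¬ Q t) → ¬ (AtLeastTwo p P x y z × AllThree p Q x y z)
  AtLeastTwo-AllThree-disjoint P⇒¬Q = λ where
    (inj₁ (px , _)        , qx , _)  → P⇒¬Q x px qx
    (inj₂ (inj₁ (px , _)) , qx , _)  → P⇒¬Q x px qx
    (inj₂ (inj₂ (py , _)) , _ , qy , _)  → P⇒¬Q y py qy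

lemma3p3 : (p : ℕ) → .{{_ : NonZero p}} → Prime p → 5 < p →
    (x y z : Fin p) → Singular p x y z →
    (¬ ((Hyperbolic p x ⊎ Hyperbolic p y ⊎ Hyperbolic p z)
        × (Elliptic p x ⊎ Elliptic p y ⊎ Elliptic p z)))
    × ExactlyOne p
        (AtLeastTwo p (Hyperbolic p) x y z)
        (AtLeastTwo p (Elliptic p) x y z)
        (AllThree p (Parabolic p) x y z)
lemma3p3 p p-prime _ x y z singular =
    singular⇒¬hyperbolic×elliptic sing
  , singular⇒alternatives sing
  , AtLeastTwo-disjoint x y z hyperbolic⇒¬elliptic
  , AtLeastTwo-AllThree-disjoint x y z hyperbolic⇒¬parabolic
  , AtLeastTwo-AllThree-disjoint x y z elliptic⇒¬parabolic
  where
  open SingularTriples p p-prime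
  sing : SingularTriple x y z
  sing = singular⇒SingularTriple singular
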